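{- For the fan graph $F_{1,n}$, \[\beta(F_{1,n})+\beta(\overline{F_{1,n}})=\begin{cases} \frac{3n-2}{2} & \text{if $n$ is even},\\ \frac{3n-3}{2} & \text{if $n$ is odd},\end{cases}\] and \[\beta(F_{1,n})\cdot\beta(\overline{F_{1,n}})=\begin{cases} \frac{n^2-4}{2} & \text{if $n$ is even},\\ \frac{(n+1)(n-2)}{2} & \text{if $n$ is odd}.\end{cases}\]
   Context: All graphs are simple and finite. The fan graph $F_{1,n}$ is the join $K_1 + P_n$ of a single vertex with the path $P_n$ on $n$ vertices (the extra vertex is adjacent to every vertex of the path); it has $n+1$ vertices. For a graph $G$, $\beta(G)$ denotes the vertex cover number of $G$: the minimum cardinality of a set $S$ of vertices such that every edge of $G$ has at least one end in $S$. $\overline{G}$ denotes the complement of $G$: the graph on the same vertex set in which two distinct vertices are adjacent if and only if they are not adjacent in $G$. -}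

module Defs where

open import Data.Nat using (ℕ; zero; suc; _+_; _≤_)
open import Data.Nat.Properties using (1+n≢n)
import Data.Nat as ℕ
open import Data.Empty using (⊥-elim)
open import Relation.Nullary using (yes; no)
open import Relation.Binary.PropositionalEquality using (sym)
open import Data.Bool using (Bool; true; false; not; _∧_; _∨_)
open import Data.Bool.Properties using (∨-comm; ∧-comm)
open import Data.Fin using (Fin; zero; suc; toℕ; _≟_)
open import Data.Fin.Subset using (Subset; _∈_; ∣_∣)
open import Data.Sum using (_⊎_)
open import Data.Product using (Σ; _×_)
open import Relation.Nullary.Decidable using (⌊_⌋)
open import Relation.Binary.PropositionalEquality using (_≡_; refl; cong)

record Graph (m : ℕ) : Set where
  field
    adj     : Fin m → Fin m → Bool
    adj-sym : ∀ i j → adj i j ≡ adj j i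
    adj-irr : ∀ i → adj i i ≡ false
open Graph public

complement : ∀ {m} → Graph m → Graph m
complement {m} G = record { adj = a ; adj-sym = s ; adj-irr = r }
  where
  a : Fin m → Fin m → Bool
  a i j = not (adj G i j) ∧ not ⌊ i ≟ j ⌋
  eqsym : ∀ (i j : Fin m) → ⌊ i ≟ j ⌋ ≡ ⌊ j ≟ i ⌋
  eqsym i j with i ≟ j | j ≟ i
  ... | yes _ | yes _ = refl
  ... | no _  | no _  = refl
  ... | yes p | no q = ⊥-elim (q (sym p))
  ... | no q | yes p = ⊥-elim (q (sym p))
  s : ∀ i j → a i j ≡ a j i
  s i j rewrite adj-sym G i j | eqsym i j = refl
  r : ∀ i → a i i ≡ false
  r i rewrite adj-irr G i = rr i
    where
    rr : ∀ i → not ⌊ i ≟ i ⌋ ≡ false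
    rr i with i ≟ i
    ... | yes _ = refl
    ... | no q = ⊥-elim (q refl)

pathAdj : ∀ {n} → Fin n → Fin n → Bool
pathAdj i j = ⌊ ℕ._≟_ (suc (toℕ i)) (toℕ j) ⌋ ∨ ⌊ ℕ._≟_ (suc (toℕ j)) (toℕ i) ⌋

-- Fan graph F_{1,n} = K_1 + P_n on Fin (suc n): vertex zero is the hub,
-- vertex (suc i) is the i-th path vertex.
fanAdj : ∀ {n} → Fin (suc n) → Fin (suc n) → Bool
fanAdj zero    zero    = false
fanAdj zero    (suc _) = true
fanAdj (suc _) zero    = true
fanAdj (suc i) (suc j) = pathAdj i j

fanAdj-sym : ∀ {n} (i j : Fin (suc n)) → fanAdj i j ≡ fanAdj j i
fanAdj-sym zero zero = refl
fanAdj-sym zero (suc j) = refl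
fanAdj-sym (suc i) zero = refl
fanAdj-sym (suc i) (suc j) = ∨-comm ⌊ ℕ._≟_ (suc (toℕ i)) (toℕ j) ⌋ ⌊ ℕ._≟_ (suc (toℕ j)) (toℕ i) ⌋

fanAdj-irr : ∀ {n} (i : Fin (suc n)) → fanAdj i i ≡ false
fanAdj-irr zero = refl
fanAdj-irr (suc i) with ℕ._≟_ (suc (toℕ i)) (toℕ i)
... | yes p = ⊥-elim (1+n≢n p)
... | no _ = refl

fan : (n : ℕ) → Graph (suc n)
fan n = record { adj = fanAdj ; adj-sym = fanAdj-sym ; adj-irr = fanAdj-irr }

IsVertexCover : ∀ {m} → Graph m → Subset m → Set
IsVertexCover G S = ∀ i j → adj G i j ≡ true → (i ∈ S ⊎ j ∈ S)

IsVertexCoverNumber : ∀ {m} → Graph m → ℕ → Set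
IsVertexCoverNumber G k =
  Σ (Subset _) (λ S → IsVertexCover G S × ∣ S ∣ ≡ k)
  × (∀ S → IsVertexCover G S → k ≤ ∣ S ∣)

module Submission where

-- The two vertex cover numbers of the fan F_{1,n} = K_1 + P_n (n ≥ 2) are
--
--   β(F_{1,n}) = 1 + ⌊n/2⌋        and        β(complement F_{1,n}) = n - 2,
--
-- from which the stated sums and products follow by arithmetic on the parity
-- of n.  Both values come from the corresponding facts about the path P_n.
--   * A cover of P_n contains an end of each of the ⌊n/2⌋ disjoint edges
--     {0,1}, {2,3}, …, and the alternating set {1,3,5,…} is such a cover.
--     In F_{1,n} a cover either contains the hub (and then covers the path)
--     or misses it (and then contains all n path vertices, n ≥ 1 + ⌊n/2⌋).
--   * In the complement of P_n a vertex outside a cover forces every vertex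
--     at path distance ≥ 2 from it into the cover, which gives n - 2 by
--     induction; omitting two consecutive path vertices attains it.  In the
--     complement of F_{1,n} the hub is isolated, so only the path part counts.

open import Defs
open import Data.Nat using (ℕ; zero; suc; _+_; _*_; _∸_; _≤_; z≤n; s≤s; ⌊_/2⌋)
open import Data.Nat.Properties
  using (+-suc; +-comm; m+n∸n≡m; ≤-refl; ≤-trans; ⌊n/2⌋<n; module ≤-Reasoning)
open import Data.Nat.Divisibility using (_∣_; divides; ∣-refl; ∣1⇒≡1; ∣m+n∣m⇒∣n; ∣m∣n⇒∣m+n)
open import Data.Nat.Tactic.RingSolver using (solve-∀)
open import Data.Product using (Σ; _×_; _,_; proj₁; proj₂)
open import Data.Sum using (_⊎_; inj₁; inj₂)
import Data.Sum as Sum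
open import Data.Bool using (Bool; true; false; not; _∧_; _∨_)
open import Data.Fin using (Fin; zero; suc; toℕ; _≟_)
open import Data.Fin.Subset using (Subset; _∈_; ∣_∣; inside; outside; ⊤)
open import Data.Fin.Subset.Properties using (drop-there; ∈⊤; ∣⊤∣≡n; ∣p∣≤∣x∷p∣; p⊆q⇒∣p∣≤∣q∣)
open import Data.Vec using ([]; _∷_; here; there)
open import Relation.Nullary using (¬_; contradiction)
open import Relation.Nullary.Decidable using (⌊_⌋; isYes≗does; ⌊⌋-map′)
open import Relation.Binary.PropositionalEquality
  using (_≡_; refl; sym; trans; cong; cong₂; subst)
import Data.Nat as ℕ

-- Adjacency and equality tests are invariant under shifting both vertices
-- by one; this is what lets covers be restricted to the tail of the path.

private
  ≟ℕ-suc : ∀ a b → ⌊ suc a ℕ.≟ suc b ⌋ ≡ ⌊ a ℕ.≟ b ⌋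
  ≟ℕ-suc a b = trans (isYes≗does (suc a ℕ.≟ suc b)) (sym (isYes≗does (a ℕ.≟ b)))

pathAdj-suc : ∀ {n} (i j : Fin n) → pathAdj (suc i) (suc j) ≡ pathAdj i j
pathAdj-suc i j = cong₂ _∨_ (≟ℕ-suc (suc (toℕ i)) (toℕ j)) (≟ℕ-suc (suc (toℕ j)) (toℕ i))

≟-suc : ∀ {n} (i j : Fin n) → ⌊ suc i ≟ suc j ⌋ ≡ ⌊ i ≟ j ⌋
≟-suc i j = ⌊⌋-map′ _ _ (i ≟ j)

all∈⇒size : ∀ {n} (p : Subset n) → (∀ i → i ∈ p) → n ≤ ∣ p ∣
all∈⇒size {n} p all∈ = subst (_≤ ∣ p ∣) (∣⊤∣≡n n) (p⊆q⇒∣p∣≤∣q∣ {p = ⊤} (λ {i} _ → all∈ i))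

PathCover : ∀ {n} → Subset n → Set
PathCover {n} p = ∀ (i j : Fin n) → pathAdj i j ≡ true → i ∈ p ⊎ j ∈ p

-- Removing the first vertex of P_n leaves the path P_{n-1}.
pathCover-tail : ∀ {n} x (p : Subset n) → PathCover (x ∷ p) → PathCover p
pathCover-tail x p cov i j e =
  Sum.map drop-there drop-there (cov (suc i) (suc j) (trans (pathAdj-suc i j) e))

edge-counted : ∀ {n} x y (p : Subset n) →
               zero ∈ (x ∷ y ∷ p) ⊎ suc zero ∈ (x ∷ y ∷ p) → suc ∣ p ∣ ≤ ∣ x ∷ y ∷ p ∣
edge-counted inside  y p _ = s≤s (∣p∣≤∣x∷p∣ y p)
edge-counted outside inside p _ = ≤-refl
edge-counted outside outside p (inj₁ ())
edge-counted outside outside p (inj₂ (there ()))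

-- Lower bound: the edges {0,1}, {2,3}, … are disjoint, so β(P_n) ≥ ⌊n/2⌋.
pathCover-size : ∀ {n} (p : Subset n) → PathCover p → ⌊ n /2⌋ ≤ ∣ p ∣
pathCover-size []           cov = z≤n
pathCover-size (x ∷ [])     cov = z≤n
pathCover-size (x ∷ y ∷ p) cov = begin
  suc ⌊ _ /2⌋    ≤⟨ s≤s (pathCover-size p (pathCover-tail y p (pathCover-tail x (y ∷ p) cov))) ⟩
  suc ∣ p ∣      ≤⟨ edge-counted x y p (cov zero (suc zero) refl) ⟩
  ∣ x ∷ y ∷ p ∣  ∎
  where open ≤-Reasoning

-- The alternating set, starting in or out; `alternating false` picks every
-- second vertex starting from the second one.
alternating : Bool → (n : ℕ) → Subset n
alternating b zero    = []
alternating b (suc n) = b ∷ alternating (not b) n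

-- Consecutive vertices of an alternating set differ in membership, so it
-- meets every edge {i, i+1} of the path.
alternating-cover : ∀ b n → PathCover (alternating b n)
alternating-cover b (suc (suc n)) zero (suc zero) e = edge b
  where
  edge : ∀ b → zero ∈ alternating b (2 + n) ⊎ suc zero ∈ alternating b (2 + n)
  edge true  = inj₁ here
  edge false = inj₂ (there here)
alternating-cover b (suc (suc n)) (suc zero) zero e =
  Sum.swap (alternating-cover b (suc (suc n)) zero (suc zero) refl)
alternating-cover b (suc n) (suc i) (suc j) e =
  Sum.map there there (alternating-cover (not b) n i j (trans (sym (pathAdj-suc i j)) e))
alternating-cover b (suc zero)    zero zero ()
alternating-cover b (suc (suc n)) zero zero ()
alternating-cover b (suc (suc n)) zero (suc (suc j)) ()
alternating-cover b (suc (suc n)) (suc (suc i)) zero ()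

∣alternating∣ : ∀ n → ∣ alternating false n ∣ ≡ ⌊ n /2⌋
∣alternating∣ zero          = refl
∣alternating∣ (suc zero)    = refl
∣alternating∣ (suc (suc n)) = cong suc (∣alternating∣ n)

coPathAdj : ∀ {n} → Fin n → Fin n → Bool
coPathAdj i j = not (pathAdj i j) ∧ not ⌊ i ≟ j ⌋

CoPathCover : ∀ {n} → Subset n → Set
CoPathCover {n} p = ∀ (i j : Fin n) → coPathAdj i j ≡ true → i ∈ p ⊎ j ∈ p

coPathAdj-suc : ∀ {n} (i j : Fin n) → coPathAdj (suc i) (suc j) ≡ coPathAdj i j
coPathAdj-suc i j = cong₂ (λ a e → not a ∧ not e) (pathAdj-suc i j) (≟-suc i j)

coPathCover-tail : ∀ {n} x (p : Subset n) → CoPathCover (x ∷ p) → CoPathCover p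
coPathCover-tail x p cov i j e =
  Sum.map drop-there drop-there (cov (suc i) (suc j) (trans (coPathAdj-suc i j) e))

suc∸2≤ : ∀ k x → k ∸ 2 ≤ x → suc k ∸ 2 ≤ suc x
suc∸2≤ zero          x _ = z≤n
suc∸2≤ (suc zero)    x _ = z≤n
suc∸2≤ (suc (suc k)) x k∸2≤x = s≤s k∸2≤x

-- Lower bound: if vertex 0 is missed, the vertices 2, …, n-1 are all
-- complement-adjacent to it and must be in the cover.
coPathCover-size : ∀ {n} (p : Subset n) → CoPathCover p → n ∸ 2 ≤ ∣ p ∣
coPathCover-size [] cov = z≤n
coPathCover-size {suc k} (inside ∷ p) cov =
  suc∸2≤ k ∣ p ∣ (coPathCover-size p (coPathCover-tail inside p cov))
coPathCover-size (outside ∷ []) cov = z≤n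
coPathCover-size (outside ∷ y ∷ p) cov =
  ≤-trans (all∈⇒size p far∈p) (∣p∣≤∣x∷p∣ y p)
  where
  far∈p : ∀ j → j ∈ p
  far∈p j with cov zero (suc (suc j)) refl
  ... | inj₂ (there (there j∈p)) = j∈p

twoOmitted-cover : ∀ m → CoPathCover (outside ∷ outside ∷ ⊤ {m})
twoOmitted-cover m (suc (suc i)) j e = inj₁ (there (there ∈⊤))
twoOmitted-cover m i (suc (suc j)) e = inj₂ (there (there ∈⊤))
twoOmitted-cover m zero zero ()
twoOmitted-cover m zero (suc zero) ()
twoOmitted-cover m (suc zero) zero ()
twoOmitted-cover m (suc zero) (suc zero) ()

fanCover-path : ∀ {n} x (p : Subset n) → IsVertexCover (fan n) (x ∷ p) → PathCover p
fanCover-path x p cov i j e = Sum.map drop-there drop-there (cov (suc i) (suc j) e)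

fanCover-noHub : ∀ {n} (p : Subset n) → IsVertexCover (fan n) (outside ∷ p) → ∀ i → i ∈ p
fanCover-noHub p cov i with cov zero (suc i) refl
... | inj₂ (there i∈p) = i∈p

-- β(F_{1,k+1}) = 1 + ⌊(k+1)/2⌋: the hub plus an alternating path cover.
β-fan : ∀ k → IsVertexCoverNumber (fan (suc k)) (suc ⌊ suc k /2⌋)
β-fan k = (inside ∷ alternating false (suc k) , cover , cong suc (∣alternating∣ (suc k))) , minimal
  where
  cover : IsVertexCover (fan (suc k)) (inside ∷ alternating false (suc k))
  cover zero    j       e = inj₁ here
  cover (suc i) zero    e = inj₂ here
  cover (suc i) (suc j) e = Sum.map there there (alternating-cover false (suc k) i j e)

  minimal : ∀ S → IsVertexCover (fan (suc k)) S → suc ⌊ suc k /2⌋ ≤ ∣ S ∣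
  minimal (inside ∷ p) cov = s≤s (pathCover-size p (fanCover-path inside p cov))
  minimal (outside ∷ p) cov =
    ≤-trans (⌊n/2⌋<n k) (all∈⇒size p (fanCover-noHub p cov))

-- In the complement of the fan the hub is isolated and the path vertices
-- span the complement of P_n.
complementFanCover⇔ : ∀ {n} x (p : Subset n) →
  (IsVertexCover (complement (fan n)) (x ∷ p) → CoPathCover p) ×
  (CoPathCover p → IsVertexCover (complement (fan n)) (x ∷ p))
complementFanCover⇔ {n} x p = restrict , extend
  where
  pathPart : ∀ (i j : Fin n) → adj (complement (fan n)) (suc i) (suc j) ≡ coPathAdj i j
  pathPart i j = cong (λ e → not (pathAdj i j) ∧ not e) (≟-suc i j)
  restrict : IsVertexCover (complement (fan n)) (x ∷ p) → CoPathCover p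
  restrict cov i j e =
    Sum.map drop-there drop-there (cov (suc i) (suc j) (subst (_≡ true) (sym (pathPart i j)) e))
  extend : CoPathCover p → IsVertexCover (complement (fan n)) (x ∷ p)
  extend cov zero    zero    ()
  extend cov zero    (suc j) ()
  extend cov (suc i) zero    ()
  extend cov (suc i) (suc j) e =
    Sum.map there there (cov i j (subst (_≡ true) (pathPart i j) e))

-- β(complement F_{1,m+2}) = m: all path vertices but the first two.
β-complementFan : ∀ m → IsVertexCoverNumber (complement (fan (suc (suc m)))) m
β-complementFan m =
  (outside ∷ omitted , proj₂ (complementFanCover⇔ outside omitted) (twoOmitted-cover m) , ∣⊤∣≡n m)
  , minimal
  where
  omitted : Subset (suc (suc m))
  omitted = outside ∷ outside ∷ ⊤

  minimal : ∀ T → IsVertexCover (complement (fan (suc (suc m)))) T → m ≤ ∣ T ∣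
  minimal (x ∷ p) cov =
    ≤-trans (coPathCover-size p (proj₁ (complementFanCover⇔ x p) cov)) (∣p∣≤∣x∷p∣ x p)

halves : ∀ m → m ≡ ⌊ m /2⌋ + ⌊ m /2⌋ ⊎ m ≡ suc (⌊ m /2⌋ + ⌊ m /2⌋)
halves zero          = inj₁ refl
halves (suc zero)    = inj₂ refl
halves (suc (suc m)) = Sum.map (λ e → trans (cong (2 +_) e) (twice-suc h))
                               (λ e → trans (cong (2 +_) e) (cong suc (twice-suc h)))
                               (halves m)
  where
  h : ℕ
  h = ⌊ m /2⌋
  twice-suc : ∀ h → 2 + (h + h) ≡ suc h + suc h
  twice-suc h = cong suc (sym (+-suc h h))

2∣h+h : ∀ h → 2 ∣ h + h
2∣h+h h = divides h (double h)
  where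
  double : ∀ h → h + h ≡ h * 2
  double = solve-∀

¬2∣1+h+h : ∀ h → ¬ 2 ∣ suc (h + h)
¬2∣1+h+h h 2∣odd with ∣1⇒≡1 (∣m+n∣m⇒∣n (subst (2 ∣_) (+-comm 1 (h + h)) 2∣odd) (2∣h+h h))
... | ()

∸-cancel : ∀ {x} y k → x ≡ y + k → x ∸ k ≡ y
∸-cancel y k refl = m+n∸n≡m y k

-- With n = 2 + m, b = 2 + h, b̄ = m and m = h + h.
evenIdentities : ∀ h m → m ≡ h + h →
  (2 * (suc (suc h) + m) ≡ 3 * (2 + m) ∸ 2) × (2 * (suc (suc h) * m) ≡ (2 + m) * (2 + m) ∸ 4)
evenIdentities h .(h + h) refl = sym (∸-cancel _ 2 (sum h)) , sym (∸-cancel _ 4 (product h))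
  where
  sum : ∀ h → 3 * (2 + (h + h)) ≡ 2 * (suc (suc h) + (h + h)) + 2
  sum = solve-∀
  product : ∀ h → (2 + (h + h)) * (2 + (h + h)) ≡ 2 * (suc (suc h) * (h + h)) + 4
  product = solve-∀

-- With n = 2 + m, b = 2 + h, b̄ = m and m = 1 + h + h.
oddIdentities : ∀ h m → m ≡ suc (h + h) →
  (2 * (suc (suc h) + m) ≡ 3 * (2 + m) ∸ 3) × (2 * (suc (suc h) * m) ≡ (2 + m + 1) * m)
oddIdentities h .(suc (h + h)) refl = sym (∸-cancel _ 3 (sum h)) , product h
  where
  sum : ∀ h → 3 * (3 + (h + h)) ≡ 2 * (suc (suc h) + suc (h + h)) + 3
  sum = solve-∀
  product : ∀ h → 2 * (suc (suc h) * suc (h + h)) ≡ (3 + (h + h) + 1) * suc (h + h)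
  product = solve-∀

mainTheorem5 : (n : ℕ) → 2 ≤ n →
    Σ ℕ (λ b → Σ ℕ (λ b̄ →
      IsVertexCoverNumber (fan n) b × IsVertexCoverNumber (complement (fan n)) b̄
      × (2 ∣ n → (2 * (b + b̄) ≡ 3 * n ∸ 2) × (2 * (b * b̄) ≡ n * n ∸ 4))
      × (¬ (2 ∣ n) → (2 * (b + b̄) ≡ 3 * n ∸ 3) × (2 * (b * b̄) ≡ (n + 1) * (n ∸ 2)))))
mainTheorem5 (suc (suc m)) (s≤s (s≤s z≤n)) =
  b , m , β-fan (suc m) , β-complementFan m , whenEven , whenOdd
  where
  h b : ℕ
  h = ⌊ m /2⌋
  b = suc (suc h)

  whenEven : 2 ∣ 2 + m → (2 * (b + m) ≡ 3 * (2 + m) ∸ 2) × (2 * (b * m) ≡ (2 + m) * (2 + m) ∸ 4)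
  whenEven 2∣n with halves m
  ... | inj₁ m≡h+h  = evenIdentities h m m≡h+h
  ... | inj₂ m≡1+h+h = contradiction (subst (2 ∣_) m≡1+h+h (∣m+n∣m⇒∣n 2∣n ∣-refl)) (¬2∣1+h+h h)

  whenOdd : ¬ 2 ∣ 2 + m → (2 * (b + m) ≡ 3 * (2 + m) ∸ 3) × (2 * (b * m) ≡ (2 + m + 1) * m)
  whenOdd 2∤n with halves m
  ... | inj₂ m≡1+h+h = oddIdentities h m m≡1+h+h
  ... | inj₁ m≡h+h  = contradiction (∣m∣n⇒∣m+n ∣-refl (subst (2 ∣_) (sym m≡h+h) (2∣h+h h))) 2∤n
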